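{- Let $G$ be a finite simple graph, let $I$ be a maximum critical independent set in $G$, and set $X=I\cup N(I)$. Then $\operatorname{diadem}(G)\subseteq \operatorname{diadem}(G[X])$ and $\operatorname{nucleus}(G[X])\subseteq \operatorname{nucleus}(G)$.
   Context: $G[X]$ is the subgraph induced by $X$. For $Y\subseteq V(H)$ in a graph $H$, $N_H(Y)$ is the union of the neighborhoods of vertices of $Y$, and $d_H(Y)=|Y|-|N_H(Y)|$. A set is independent if no two of its vertices are adjacent. An independent set $A$ of $H$ is critical (in $H$) if $d_H(A)=\max\{d_H(Y):Y\subseteq V(H)\}$; the empty set may be critical. A maximum critical independent set is a critical independent set of maximum cardinality. $\operatorname{diadem}(H)$ is the union, and $\operatorname{nucleus}(H)$ the intersection, of all maximum critical independent sets of $H$ (both empty if $\emptyset$ is the only critical independent set, in particular for the empty graph). -}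

module Defs where

open import Data.Nat using (ℕ; zero; suc)
open import Data.Bool using (Bool; true; false; _∧_; _∨_)
open import Data.Fin using (Fin)
import Data.Fin as F
open import Data.Fin.Subset using (Subset; _∈_; _⊆_; ∣_∣)
open import Data.Vec using (tabulate; lookup)
open import Data.Integer using (ℤ; _-_; +_; _≤_)
open import Data.Product using (Σ; _×_)
open import Relation.Binary.PropositionalEquality using (_≡_)

record Graph (n : ℕ) : Set where
  field
    adj     : Fin n → Fin n → Bool
    sym     : ∀ u v → adj u v ≡ adj v u
    irrefl  : ∀ v → adj v v ≡ false
open Graph public

anyFin : ∀ {n} → (Fin n → Bool) → Bool
anyFin {zero}  f = false
anyFin {suc n} f = f F.zero ∨ anyFin (λ i → f (F.suc i))

-- All notions below are relative to an induced subgraph G[W] of G, represented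
-- by its vertex set W ⊆ V(G) (vertices keep their labels).  G itself is G[⊤].

N : ∀ {n} → Graph n → Subset n → Subset n → Subset n
N G W Y = tabulate λ v → lookup W v ∧ anyFin (λ u → lookup Y u ∧ adj G u v)

d : ∀ {n} → Graph n → Subset n → Subset n → ℤ
d G W Y = + ∣ Y ∣ - + ∣ N G W Y ∣

Independent : ∀ {n} → Graph n → Subset n → Set
Independent G A = ∀ u v → u ∈ A → v ∈ A → adj G u v ≡ false

Critical : ∀ {n} → Graph n → Subset n → Subset n → Set
Critical G W A = A ⊆ W × Independent G A × (∀ Y → Y ⊆ W → d G W Y ≤ d G W A)

MaxCritical : ∀ {n} → Graph n → Subset n → Subset n → Set
MaxCritical G W A = Critical G W A × (∀ B → Critical G W B → ∣ B ∣ Data.Nat.≤ ∣ A ∣)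

InDiadem : ∀ {n} → Graph n → Subset n → Fin n → Set
InDiadem G W v = Σ (Subset _) λ A → MaxCritical G W A × v ∈ A

InNucleus : ∀ {n} → Graph n → Subset n → Fin n → Set
InNucleus G W v = ∀ A → MaxCritical G W A → v ∈ A

-- Every maximum critical independent set A of G is also one of G[X], X = I ∪ N(I), which gives
-- both inclusions at once.  For A ⊆ X: with U = A ∪ I, the set K = I ∪ (U ─ N(U)) is critical
-- (unions of critical sets are critical, and deleting N(U) from U does not decrease d) and
-- independent, so K = I by maximality of I; a vertex of A outside N(I) has no neighbour in U,
-- hence lies in K.  Criticality of I gives the Hall-type inequality |S| ≤ |I ∩ N(S)| for
-- S ⊆ N(I); with it, d_X(Y) ≤ d(Y ∩ I) ≤ d(I) ≤ d(A) ≤ d_X(A) for every Y ⊆ X, and every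
-- independent B ⊆ X has |B| ≤ |I| ≤ |A|.
module Submission where

open import Defs
open import Data.Nat using (ℕ)
open import Data.Fin using (Fin)
open import Data.Fin.Subset using (Subset; ⊤; _∪_)
open import Data.Product using (_×_)

open import Data.Bool using (Bool; true; false; _∧_; _∨_)
open import Data.Bool.Properties using (∧-conicalˡ; ∧-conicalʳ; ∨-zeroʳ; not-¬; ¬-not)
open import Data.Fin using (zero; suc)
open import Data.Fin.Subset using (_∈_; _∉_; _⊆_; _∩_; _─_; ∣_∣; Empty; inside; outside)
open import Data.Fin.Subset.Properties
  using (∈⊤; ⊆⊤; _∈?_; ∩-comm; ⊆-antisym; p∩q⊆p; p∩q⊆q; x∈p∩q⁺; x∈p∩q⁻; p⊆p∪q; q⊆p∪q; x∈p∪q⁻;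
         x∈p∧x∉q⇒x∈p─q; p─q⊆p; p⊆q⇒∣p∣≤∣q∣; p⊂q⇒∣p∣<∣q∣; Empty-unique; ∣⊥∣≡0)
open import Data.Integer as ℤ using (_⊖_)
import Data.Integer.Properties as ℤ
import Data.Nat as ℕ
import Data.Nat.Properties as ℕ
open import Data.Nat using (_+_)
open import Algebra.Properties.CommutativeSemigroup ℕ.+-commutativeSemigroup using (interchange; x∙yz≈y∙xz)
open import Data.Vec using ([]; _∷_; there; lookup)
open import Data.Vec.Properties using (lookup∘tabulate; []=⇒lookup; lookup⇒[]=)
open import Data.Product using (_,_; proj₁; ∃-syntax)
open import Data.Sum using (inj₁; inj₂)
open import Function using (_∘_; _⇔_; mk⇔; Equivalence)
open import Relation.Nullary using (yes; no; contradiction)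
import Relation.Binary.PropositionalEquality as ≡
open ≡ using (_≡_; _≢_; refl; cong; cong₂; subst₂)

open Equivalence using (to; from)

private
  variable
    n : ℕ

x∈p─q⇒x∉q : ∀ {x : Fin n} {p q} → x ∈ p ─ q → x ∉ q
x∈p─q⇒x∉q {p = _ ∷ _} {inside ∷ _}  (there x∈p─q) (there x∈q) = x∈p─q⇒x∉q x∈p─q x∈q
x∈p─q⇒x∉q {p = _ ∷ _} {outside ∷ _} (there x∈p─q) (there x∈q) = x∈p─q⇒x∉q x∈p─q x∈q

∣p∣≡∣p∩q∣+∣p─q∣ : ∀ (p q : Subset n) → ∣ p ∣ ≡ ∣ p ∩ q ∣ + ∣ p ─ q ∣
∣p∣≡∣p∩q∣+∣p─q∣ []            []            = refl
∣p∣≡∣p∩q∣+∣p─q∣ (inside ∷ p)  (inside ∷ q)  = cong ℕ.suc (∣p∣≡∣p∩q∣+∣p─q∣ p q)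
∣p∣≡∣p∩q∣+∣p─q∣ (inside ∷ p)  (outside ∷ q) =
  ≡.trans (cong ℕ.suc (∣p∣≡∣p∩q∣+∣p─q∣ p q)) (≡.sym (ℕ.+-suc _ _))
∣p∣≡∣p∩q∣+∣p─q∣ (outside ∷ p) (inside ∷ q)  = ∣p∣≡∣p∩q∣+∣p─q∣ p q
∣p∣≡∣p∩q∣+∣p─q∣ (outside ∷ p) (outside ∷ q) = ∣p∣≡∣p∩q∣+∣p─q∣ p q

∣p∪q∣+∣p∩q∣≡∣p∣+∣q∣ : ∀ (p q : Subset n) → ∣ p ∪ q ∣ + ∣ p ∩ q ∣ ≡ ∣ p ∣ + ∣ q ∣
∣p∪q∣+∣p∩q∣≡∣p∣+∣q∣ []            []            = refl
∣p∪q∣+∣p∩q∣≡∣p∣+∣q∣ (inside ∷ p)  (inside ∷ q)  =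
  cong ℕ.suc (≡.trans (ℕ.+-suc _ _)
    (≡.trans (cong ℕ.suc (∣p∪q∣+∣p∩q∣≡∣p∣+∣q∣ p q)) (≡.sym (ℕ.+-suc _ _))))
∣p∪q∣+∣p∩q∣≡∣p∣+∣q∣ (inside ∷ p)  (outside ∷ q) = cong ℕ.suc (∣p∪q∣+∣p∩q∣≡∣p∣+∣q∣ p q)
∣p∪q∣+∣p∩q∣≡∣p∣+∣q∣ (outside ∷ p) (inside ∷ q)  =
  ≡.trans (cong ℕ.suc (∣p∪q∣+∣p∩q∣≡∣p∣+∣q∣ p q)) (≡.sym (ℕ.+-suc _ _))
∣p∪q∣+∣p∩q∣≡∣p∣+∣q∣ (outside ∷ p) (outside ∷ q) = ∣p∪q∣+∣p∩q∣≡∣p∣+∣q∣ p q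

disjoint⇒∣p∪q∣≡∣p∣+∣q∣ : ∀ {p q : Subset n} → Empty (p ∩ q) → ∣ p ∪ q ∣ ≡ ∣ p ∣ + ∣ q ∣
disjoint⇒∣p∪q∣≡∣p∣+∣q∣ {n} {p} {q} p∩q-empty = begin
  ∣ p ∪ q ∣               ≡⟨ ℕ.+-identityʳ _ ⟨
  ∣ p ∪ q ∣ + 0           ≡⟨ cong (λ k → ∣ p ∪ q ∣ + k) ∣p∩q∣≡0 ⟨
  ∣ p ∪ q ∣ + ∣ p ∩ q ∣   ≡⟨ ∣p∪q∣+∣p∩q∣≡∣p∣+∣q∣ p q ⟩
  ∣ p ∣ + ∣ q ∣           ∎
  where
  open ≡.≡-Reasoning
  ∣p∩q∣≡0 : ∣ p ∩ q ∣ ≡ 0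
  ∣p∩q∣≡0 = ≡.trans (cong ∣_∣ (Empty-unique p∩q-empty)) (∣⊥∣≡0 n)

p⊆q⇒q∩p≡p : ∀ {p q : Subset n} → p ⊆ q → q ∩ p ≡ p
p⊆q⇒q∩p≡p {p = p} {q} p⊆q = ⊆-antisym (p∩q⊆q q p) (λ x∈p → x∈p∩q⁺ (p⊆q x∈p , x∈p))

p⊆q∪r⇒p─q⊆r : ∀ {p q r : Subset n} → p ⊆ q ∪ r → p ─ q ⊆ r
p⊆q∪r⇒p─q⊆r {p = p} {q} {r} p⊆q∪r x∈p─q with x∈p∪q⁻ q r (p⊆q∪r (p─q⊆p p q x∈p─q))
... | inj₁ x∈q = contradiction x∈q (x∈p─q⇒x∉q x∈p─q)
... | inj₂ x∈r = x∈r

p⊆q∧∣q∣≤∣p∣⇒q⊆p : ∀ {p q : Subset n} → p ⊆ q → ∣ q ∣ ℕ.≤ ∣ p ∣ → q ⊆ p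
p⊆q∧∣q∣≤∣p∣⇒q⊆p {p = p} p⊆q ∣q∣≤∣p∣ {x} x∈q with x ∈? p
... | yes x∈p = x∈p
... | no  x∉p = contradiction (p⊂q⇒∣p∣<∣q∣ (p⊆q , x , x∈q , x∉p)) (ℕ.≤⇒≯ ∣q∣≤∣p∣)

⊖-cancelʳ-≤ : ∀ k {a b} → a ⊖ k ℤ.≤ b ⊖ k → a ℕ.≤ b
⊖-cancelʳ-≤ k h = ℕ.≮⇒≥ (λ b<a → ℤ.≤⇒≯ h (ℤ.⊖-monoˡ-< k b<a))

⊖-≤-⊖⇔ : ∀ a b c e → a ⊖ b ℤ.≤ c ⊖ e ⇔ a + e ℕ.≤ c + b
⊖-≤-⊖⇔ a b c e = mk⇔
  (λ h → ⊖-cancelʳ-≤ (b + e) (subst₂ ℤ._≤_ lhs rhs h))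
  (λ h → subst₂ ℤ._≤_ (≡.sym lhs) (≡.sym rhs) (ℤ.⊖-monoˡ-≤ (b + e) h))
  where
  lhs : a ⊖ b ≡ (a + e) ⊖ (b + e)
  lhs = ≡.trans (≡.sym (ℤ.+-cancelˡ-⊖ e a b)) (cong₂ _⊖_ (ℕ.+-comm e a) (ℕ.+-comm e b))
  rhs : c ⊖ e ≡ (c + b) ⊖ (b + e)
  rhs = ≡.trans (≡.sym (ℤ.+-cancelˡ-⊖ b c e)) (cong (_⊖ (b + e)) (ℕ.+-comm b c))

anyFin⁺ : ∀ (f : Fin n → Bool) u → f u ≡ true → anyFin f ≡ true
anyFin⁺ f zero    fu = cong (_∨ anyFin (f ∘ suc)) fu
anyFin⁺ f (suc u) fu = ≡.trans (cong (f zero ∨_) (anyFin⁺ (f ∘ suc) u fu)) (∨-zeroʳ (f zero))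

anyFin⁻ : ∀ (f : Fin n → Bool) → anyFin f ≡ true → ∃[ u ] f u ≡ true
anyFin⁻ {ℕ.suc n} f h with f zero in fz
... | true  = zero , fz
... | false = let u , fu = anyFin⁻ (f ∘ suc) h in suc u , fu

module _ (G : Graph n) where

  ∈N⁺ : ∀ {W Y : Subset n} {u v} → v ∈ W → u ∈ Y → adj G u v ≡ true → v ∈ N G W Y
  ∈N⁺ {Y = Y} {u} {v} v∈W u∈Y uv = lookup⇒[]= v _ (≡.trans (lookup∘tabulate _ v)
    (cong₂ _∧_ ([]=⇒lookup v∈W) (anyFin⁺ (λ w → lookup Y w ∧ adj G w v) u (cong₂ _∧_ ([]=⇒lookup u∈Y) uv))))

  ∈N⁻ : ∀ W Y {v} → v ∈ N G W Y → v ∈ W × ∃[ u ] u ∈ Y × adj G u v ≡ true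
  ∈N⁻ W Y {v} v∈N
    with e ← ≡.trans (≡.sym (lookup∘tabulate _ v)) ([]=⇒lookup v∈N)
    with u , e′ ← anyFin⁻ (λ w → lookup Y w ∧ adj G w v) (∧-conicalʳ _ _ e)
    = lookup⇒[]= v W (∧-conicalˡ _ _ e) , u , lookup⇒[]= u Y (∧-conicalˡ _ _ e′) , ∧-conicalʳ _ _ e′

  d≤d⇔ : ∀ W Y W′ Z → d G W Y ℤ.≤ d G W′ Z ⇔ ∣ Y ∣ + ∣ N G W′ Z ∣ ℕ.≤ ∣ Z ∣ + ∣ N G W Y ∣
  d≤d⇔ W Y W′ Z rewrite ℤ.[+m]-[+n]≡m⊖n (∣ Y ∣) (∣ N G W Y ∣)
                      | ℤ.[+m]-[+n]≡m⊖n (∣ Z ∣) (∣ N G W′ Z ∣) =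
    ⊖-≤-⊖⇔ (∣ Y ∣) (∣ N G W Y ∣) (∣ Z ∣) (∣ N G W′ Z ∣)

  adj-sym : ∀ {u v} → adj G u v ≡ true → adj G v u ≡ true
  adj-sym {u} {v} = ≡.trans (sym G v u)

  independent⇒¬adjacent : ∀ {A u v} → Independent G A → u ∈ A → v ∈ A → adj G u v ≢ true
  independent⇒¬adjacent ind-A u∈A v∈A = not-¬ (ind-A _ _ u∈A v∈A)

  ∪-independent : ∀ {p q} → Independent G p → Independent G q →
                  (∀ {u v} → u ∈ p → v ∈ q → adj G u v ≡ false) → Independent G (p ∪ q)
  ∪-independent {p} {q} ind-p ind-q cross u v u∈p∪q v∈p∪q with x∈p∪q⁻ p q u∈p∪q | x∈p∪q⁻ p q v∈p∪q
  ... | inj₁ u∈p | inj₁ v∈p = ind-p u v u∈p v∈p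
  ... | inj₁ u∈p | inj₂ v∈q = cross u∈p v∈q
  ... | inj₂ u∈q | inj₁ v∈p = ≡.trans (sym G u v) (cross v∈p u∈q)
  ... | inj₂ u∈q | inj₂ v∈q = ind-q u v u∈q v∈q

  N-monoˡ : ∀ {W W′ : Subset n} Y → W ⊆ W′ → N G W Y ⊆ N G W′ Y
  N-monoˡ {W} Y W⊆W′ v∈N with v∈W , u , u∈Y , uv ← ∈N⁻ W Y v∈N = ∈N⁺ (W⊆W′ v∈W) u∈Y uv

  d-antimonoˡ : ∀ {W W′ Y : Subset n} → W ⊆ W′ → d G W′ Y ℤ.≤ d G W Y
  d-antimonoˡ {W} {W′} {Y} W⊆W′ =
    from (d≤d⇔ W′ Y W Y) (ℕ.+-monoʳ-≤ (∣ Y ∣) (p⊆q⇒∣p∣≤∣q∣ (N-monoˡ Y W⊆W′)))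

  ∣N[p∪q]∣+∣N[p∩q]∣≤∣Np∣+∣Nq∣ : ∀ W (p q : Subset n) →
    ∣ N G W (p ∪ q) ∣ + ∣ N G W (p ∩ q) ∣ ℕ.≤ ∣ N G W p ∣ + ∣ N G W q ∣
  ∣N[p∪q]∣+∣N[p∩q]∣≤∣Np∣+∣Nq∣ W p q = begin
    ∣ N G W (p ∪ q) ∣ + ∣ N G W (p ∩ q) ∣
      ≤⟨ ℕ.+-mono-≤ (p⊆q⇒∣p∣≤∣q∣ N[p∪q]⊆) (p⊆q⇒∣p∣≤∣q∣ N[p∩q]⊆) ⟩
    ∣ N G W p ∪ N G W q ∣ + ∣ N G W p ∩ N G W q ∣
      ≡⟨ ∣p∪q∣+∣p∩q∣≡∣p∣+∣q∣ (N G W p) (N G W q) ⟩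
    ∣ N G W p ∣ + ∣ N G W q ∣ ∎
    where
    open ℕ.≤-Reasoning
    N[p∪q]⊆ : N G W (p ∪ q) ⊆ N G W p ∪ N G W q
    N[p∪q]⊆ v∈N with v∈W , u , u∈p∪q , uv ← ∈N⁻ W (p ∪ q) v∈N with x∈p∪q⁻ p q u∈p∪q
    ... | inj₁ u∈p = p⊆p∪q (N G W q) (∈N⁺ v∈W u∈p uv)
    ... | inj₂ u∈q = q⊆p∪q (N G W p) (N G W q) (∈N⁺ v∈W u∈q uv)
    N[p∩q]⊆ : N G W (p ∩ q) ⊆ N G W p ∩ N G W q
    N[p∩q]⊆ v∈N with v∈W , u , u∈p∩q , uv ← ∈N⁻ W (p ∩ q) v∈N with u∈p , u∈q ← x∈p∩q⁻ p q u∈p∩q =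
      x∈p∩q⁺ (∈N⁺ v∈W u∈p uv , ∈N⁺ v∈W u∈q uv)

  CriticalSet : Subset n → Set
  CriticalSet A = ∀ Y → d G ⊤ Y ℤ.≤ d G ⊤ A

  critical⇒criticalSet : ∀ {A} → Critical G ⊤ A → CriticalSet A
  critical⇒criticalSet (_ , _ , crit-A) Y = crit-A Y ⊆⊤

  d≤d[p∪q] : ∀ {q} → CriticalSet q → ∀ p → d G ⊤ p ℤ.≤ d G ⊤ (p ∪ q)
  d≤d[p∪q] {q} crit-q p =
    from (d≤d⇔ ⊤ p ⊤ (p ∪ q)) (ℕ.+-cancelʳ-≤ (∣ q ∣ + ∣ N G ⊤ (p ∩ q) ∣) _ _ (begin
    (∣ p ∣ + ∣ N G ⊤ (p ∪ q) ∣) + (∣ q ∣ + ∣ N G ⊤ (p ∩ q) ∣)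
      ≡⟨ interchange (∣ p ∣) _ _ _ ⟩
    (∣ p ∣ + ∣ q ∣) + (∣ N G ⊤ (p ∪ q) ∣ + ∣ N G ⊤ (p ∩ q) ∣)
      ≤⟨ ℕ.+-mono-≤ (ℕ.≤-reflexive (≡.sym (∣p∪q∣+∣p∩q∣≡∣p∣+∣q∣ p q))) (∣N[p∪q]∣+∣N[p∩q]∣≤∣Np∣+∣Nq∣ ⊤ p q) ⟩
    (∣ p ∪ q ∣ + ∣ p ∩ q ∣) + (∣ N G ⊤ p ∣ + ∣ N G ⊤ q ∣)
      ≡⟨ interchange (∣ p ∪ q ∣) _ _ _ ⟩
    (∣ p ∪ q ∣ + ∣ N G ⊤ p ∣) + (∣ p ∩ q ∣ + ∣ N G ⊤ q ∣)
      ≤⟨ ℕ.+-monoʳ-≤ (∣ p ∪ q ∣ + ∣ N G ⊤ p ∣) (to (d≤d⇔ ⊤ (p ∩ q) ⊤ q) (crit-q (p ∩ q))) ⟩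
    (∣ p ∪ q ∣ + ∣ N G ⊤ p ∣) + (∣ q ∣ + ∣ N G ⊤ (p ∩ q) ∣) ∎))
    where open ℕ.≤-Reasoning

  ∪-critical : ∀ {p q} → CriticalSet p → CriticalSet q → CriticalSet (p ∪ q)
  ∪-critical {p} crit-p crit-q Y = ℤ.≤-trans (crit-p Y) (d≤d[p∪q] crit-q p)

  d≤d[p─Np] : ∀ p → d G ⊤ p ℤ.≤ d G ⊤ (p ─ N G ⊤ p)
  d≤d[p─Np] p = from (d≤d⇔ ⊤ p ⊤ (p ─ Np)) (begin
    ∣ p ∣ + ∣ N G ⊤ (p ─ Np) ∣
      ≤⟨ ℕ.+-monoʳ-≤ (∣ p ∣) (p⊆q⇒∣p∣≤∣q∣ N[p─Np]⊆) ⟩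
    ∣ p ∣ + ∣ Np ─ p ∣
      ≡⟨ cong (_+ ∣ Np ─ p ∣) (∣p∣≡∣p∩q∣+∣p─q∣ p Np) ⟩
    (∣ p ∩ Np ∣ + ∣ p ─ Np ∣) + ∣ Np ─ p ∣
      ≡⟨ ≡.trans (ℕ.+-assoc (∣ p ∩ Np ∣) _ _) (x∙yz≈y∙xz (∣ p ∩ Np ∣) (∣ p ─ Np ∣) _) ⟩
    ∣ p ─ Np ∣ + (∣ p ∩ Np ∣ + ∣ Np ─ p ∣)
      ≡⟨ cong (λ k → ∣ p ─ Np ∣ + (∣ k ∣ + ∣ Np ─ p ∣)) (∩-comm p Np) ⟩
    ∣ p ─ Np ∣ + (∣ Np ∩ p ∣ + ∣ Np ─ p ∣)
      ≡⟨ cong (λ k → ∣ p ─ Np ∣ + k) (∣p∣≡∣p∩q∣+∣p─q∣ Np p) ⟨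
    ∣ p ─ Np ∣ + ∣ Np ∣ ∎)
    where
    open ℕ.≤-Reasoning
    Np : Subset n
    Np = N G ⊤ p
    N[p─Np]⊆ : N G ⊤ (p ─ Np) ⊆ Np ─ p
    N[p─Np]⊆ {v} v∈N with _ , u , u∈p─Np , uv ← ∈N⁻ ⊤ (p ─ Np) v∈N with v ∈? p
    ... | yes v∈p = contradiction (∈N⁺ ∈⊤ v∈p (adj-sym uv)) (x∈p─q⇒x∉q u∈p─Np)
    ... | no  v∉p = x∈p∧x∉q⇒x∈p─q (∈N⁺ ∈⊤ (p─q⊆p p Np u∈p─Np) uv) v∉p

  ─N-critical : ∀ {p} → CriticalSet p → CriticalSet (p ─ N G ⊤ p)
  ─N-critical {p} crit-p Y = ℤ.≤-trans (crit-p Y) (d≤d[p─Np] p)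

  ─N-independent : ∀ p → Independent G (p ─ N G ⊤ p)
  ─N-independent p u v u∈ v∈ = ¬-not λ uv → x∈p─q⇒x∉q v∈ (∈N⁺ ∈⊤ (p─q⊆p p (N G ⊤ p) u∈) uv)

  critical⇒∣S∣≤∣I∩NS∣ : ∀ {I S} → CriticalSet I → S ⊆ N G ⊤ I → ∣ S ∣ ℕ.≤ ∣ I ∩ N G ⊤ S ∣
  critical⇒∣S∣≤∣I∩NS∣ {I} {S} crit-I S⊆NI =
    ℕ.+-cancelʳ-≤ (∣ NI ─ S ∣) _ _ (ℕ.+-cancelˡ-≤ (∣ P ∣) _ _ (begin
    ∣ P ∣ + (∣ S ∣ + ∣ NI ─ S ∣)
      ≡⟨ cong (λ k → ∣ P ∣ + k) ∣NI∣≡∣S∣+∣NI─S∣ ⟨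
    ∣ P ∣ + ∣ NI ∣
      ≤⟨ to (d≤d⇔ ⊤ P ⊤ I) (crit-I P) ⟩
    ∣ I ∣ + ∣ N G ⊤ P ∣
      ≤⟨ ℕ.+-monoʳ-≤ (∣ I ∣) (p⊆q⇒∣p∣≤∣q∣ NP⊆NI─S) ⟩
    ∣ I ∣ + ∣ NI ─ S ∣
      ≡⟨ cong (_+ ∣ NI ─ S ∣) (∣p∣≡∣p∩q∣+∣p─q∣ I (N G ⊤ S)) ⟩
    (∣ I ∩ N G ⊤ S ∣ + ∣ P ∣) + ∣ NI ─ S ∣
      ≡⟨ ℕ.+-assoc (∣ I ∩ N G ⊤ S ∣) _ _ ⟩
    ∣ I ∩ N G ⊤ S ∣ + (∣ P ∣ + ∣ NI ─ S ∣)
      ≡⟨ x∙yz≈y∙xz (∣ I ∩ N G ⊤ S ∣) (∣ P ∣) (∣ NI ─ S ∣) ⟩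
    ∣ P ∣ + (∣ I ∩ N G ⊤ S ∣ + ∣ NI ─ S ∣) ∎))
    where
    open ℕ.≤-Reasoning
    NI P : Subset n
    NI = N G ⊤ I
    P = I ─ N G ⊤ S
    ∣NI∣≡∣S∣+∣NI─S∣ : ∣ NI ∣ ≡ ∣ S ∣ + ∣ NI ─ S ∣
    ∣NI∣≡∣S∣+∣NI─S∣ = ≡.trans (∣p∣≡∣p∩q∣+∣p─q∣ NI S) (cong (λ X → ∣ X ∣ + ∣ NI ─ S ∣) (p⊆q⇒q∩p≡p S⊆NI))
    NP⊆NI─S : N G ⊤ P ⊆ NI ─ S
    NP⊆NI─S {v} v∈NP with _ , u , u∈P , uv ← ∈N⁻ ⊤ P v∈NP with v ∈? S
    ... | yes v∈S = contradiction (∈N⁺ ∈⊤ v∈S (adj-sym uv)) (x∈p─q⇒x∉q u∈P)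
    ... | no  v∉S = x∈p∧x∉q⇒x∈p─q (∈N⁺ ∈⊤ (p─q⊆p I (N G ⊤ S) u∈P) uv) v∉S

  independent⊆I∪NI⇒∣B∣≤∣I∣ : ∀ {I B} → CriticalSet I → Independent G B → B ⊆ I ∪ N G ⊤ I → ∣ B ∣ ℕ.≤ ∣ I ∣
  independent⊆I∪NI⇒∣B∣≤∣I∣ {I} {B} crit-I ind-B B⊆I∪NI = begin
    ∣ B ∣
      ≡⟨ ∣p∣≡∣p∩q∣+∣p─q∣ B I ⟩
    ∣ B ∩ I ∣ + ∣ S ∣
      ≤⟨ ℕ.+-mono-≤ (p⊆q⇒∣p∣≤∣q∣ B∩I⊆I─NS) (critical⇒∣S∣≤∣I∩NS∣ {I} crit-I S⊆NI) ⟩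
    ∣ I ─ N G ⊤ S ∣ + ∣ I ∩ N G ⊤ S ∣
      ≡⟨ ℕ.+-comm (∣ I ─ N G ⊤ S ∣) _ ⟩
    ∣ I ∩ N G ⊤ S ∣ + ∣ I ─ N G ⊤ S ∣
      ≡⟨ ∣p∣≡∣p∩q∣+∣p─q∣ I (N G ⊤ S) ⟨
    ∣ I ∣ ∎
    where
    open ℕ.≤-Reasoning
    S : Subset n
    S = B ─ I
    S⊆NI : S ⊆ N G ⊤ I
    S⊆NI = p⊆q∪r⇒p─q⊆r B⊆I∪NI
    B∩I⊆I─NS : B ∩ I ⊆ I ─ N G ⊤ S
    B∩I⊆I─NS v∈B∩I with v∈B , v∈I ← x∈p∩q⁻ B I v∈B∩I = x∈p∧x∉q⇒x∈p─q v∈I λ v∈NS →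
      let _ , u , u∈S , uv = ∈N⁻ ⊤ S v∈NS in independent⇒¬adjacent ind-B (p─q⊆p B I u∈S) v∈B uv

  d[I∪NI]≤d : ∀ {I Y} → CriticalSet I → Independent G I → Y ⊆ I ∪ N G ⊤ I →
              d G (I ∪ N G ⊤ I) Y ℤ.≤ d G ⊤ I
  d[I∪NI]≤d {I} {Y} crit-I ind-I Y⊆X = ℤ.≤-trans (from (d≤d⇔ X Y ⊤ T) (begin
    ∣ Y ∣ + ∣ N G ⊤ T ∣
      ≡⟨ cong (_+ ∣ N G ⊤ T ∣) (∣p∣≡∣p∩q∣+∣p─q∣ Y I) ⟩
    (∣ T ∣ + ∣ S ∣) + ∣ N G ⊤ T ∣
      ≡⟨ ℕ.+-assoc (∣ T ∣) _ _ ⟩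
    ∣ T ∣ + (∣ S ∣ + ∣ N G ⊤ T ∣)
      ≤⟨ ℕ.+-monoʳ-≤ (∣ T ∣) (ℕ.+-monoˡ-≤ (∣ N G ⊤ T ∣) ∣S∣≤∣I∩NS∣) ⟩
    ∣ T ∣ + (∣ I ∩ N G ⊤ S ∣ + ∣ N G ⊤ T ∣)
      ≡⟨ cong (λ k → ∣ T ∣ + k) (ℕ.+-comm (∣ I ∩ N G ⊤ S ∣) _) ⟩
    ∣ T ∣ + (∣ N G ⊤ T ∣ + ∣ I ∩ N G ⊤ S ∣)
      ≡⟨ cong (λ k → ∣ T ∣ + k) (disjoint⇒∣p∪q∣≡∣p∣+∣q∣ NT∩[I∩NS]-empty) ⟨
    ∣ T ∣ + ∣ N G ⊤ T ∪ (I ∩ N G ⊤ S) ∣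
      ≤⟨ ℕ.+-monoʳ-≤ (∣ T ∣) (p⊆q⇒∣p∣≤∣q∣ NT∪[I∩NS]⊆N[X]Y) ⟩
    ∣ T ∣ + ∣ N G X Y ∣ ∎)) (crit-I T)
    where
    open ℕ.≤-Reasoning
    X S T : Subset n
    X = I ∪ N G ⊤ I
    S = Y ─ I
    T = Y ∩ I
    ∣S∣≤∣I∩NS∣ : ∣ S ∣ ℕ.≤ ∣ I ∩ N G ⊤ S ∣
    ∣S∣≤∣I∩NS∣ = critical⇒∣S∣≤∣I∩NS∣ {I} crit-I (p⊆q∪r⇒p─q⊆r Y⊆X)
    NT∩[I∩NS]-empty : Empty (N G ⊤ T ∩ (I ∩ N G ⊤ S))
    NT∩[I∩NS]-empty (v , v∈) with v∈NT , v∈I∩NS ← x∈p∩q⁻ (N G ⊤ T) (I ∩ N G ⊤ S) v∈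
      with _ , u , u∈T , uv ← ∈N⁻ ⊤ T v∈NT =
      independent⇒¬adjacent ind-I (p∩q⊆q Y I u∈T) (proj₁ (x∈p∩q⁻ I (N G ⊤ S) v∈I∩NS)) uv
    NT∪[I∩NS]⊆N[X]Y : N G ⊤ T ∪ (I ∩ N G ⊤ S) ⊆ N G X Y
    NT∪[I∩NS]⊆N[X]Y v∈ with x∈p∪q⁻ (N G ⊤ T) (I ∩ N G ⊤ S) v∈
    ... | inj₁ v∈NT = let _ , u , u∈T , uv = ∈N⁻ ⊤ T v∈NT in
      ∈N⁺ (q⊆p∪q I (N G ⊤ I) (∈N⁺ ∈⊤ (p∩q⊆q Y I u∈T) uv)) (p∩q⊆p Y I u∈T) uv
    ... | inj₂ v∈I∩NS = let v∈I , v∈NS = x∈p∩q⁻ I (N G ⊤ S) v∈I∩NS ; _ , u , u∈S , uv = ∈N⁻ ⊤ S v∈NS in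
      ∈N⁺ (p⊆p∪q (N G ⊤ I) v∈I) (p─q⊆p Y I u∈S) uv

  critical⊆I∪NI : ∀ {I A} → MaxCritical G ⊤ I → Critical G ⊤ A → A ⊆ I ∪ N G ⊤ I
  critical⊆I∪NI {I} {A} (crit-I@(_ , ind-I , _) , max-I) crit-A@(_ , ind-A , _) {v} v∈A
    with v ∈? N G ⊤ I
  ... | yes v∈NI = q⊆p∪q I (N G ⊤ I) v∈NI
  ... | no  v∉NI = p⊆p∪q (N G ⊤ I) (K⊆I (q⊆p∪q I (U ─ N G ⊤ U) v∈U─NU))
    where
    U K : Subset n
    U = A ∪ I
    K = I ∪ (U ─ N G ⊤ U)
    I-critical : CriticalSet I
    I-critical = critical⇒criticalSet crit-I
    K-critical : CriticalSet K
    K-critical = ∪-critical {I} I-critical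
      (─N-critical {U} (∪-critical {A} (critical⇒criticalSet crit-A) I-critical))
    K-independent : Independent G K
    K-independent = ∪-independent ind-I (─N-independent U) λ u∈I w∈U─NU → ¬-not λ uw →
      x∈p─q⇒x∉q w∈U─NU (∈N⁺ ∈⊤ (q⊆p∪q A I u∈I) uw)
    K⊆I : K ⊆ I
    K⊆I = p⊆q∧∣q∣≤∣p∣⇒q⊆p (p⊆p∪q (U ─ N G ⊤ U)) (max-I K (⊆⊤ , K-independent , λ Y _ → K-critical Y))
    v∉NU : v ∉ N G ⊤ U
    v∉NU v∈NU with _ , u , u∈U , uv ← ∈N⁻ ⊤ U v∈NU with x∈p∪q⁻ A I u∈U
    ... | inj₁ u∈A = independent⇒¬adjacent ind-A u∈A v∈A uv
    ... | inj₂ u∈I = v∉NI (∈N⁺ ∈⊤ u∈I uv)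
    v∈U─NU : v ∈ U ─ N G ⊤ U
    v∈U─NU = x∈p∧x∉q⇒x∈p─q (p⊆p∪q I v∈A) v∉NU

  maxCritical⇒maxCritical[I∪NI] : ∀ {I A} → MaxCritical G ⊤ I → MaxCritical G ⊤ A →
                                  MaxCritical G (I ∪ N G ⊤ I) A
  maxCritical⇒maxCritical[I∪NI] {I} {A} max-crit-I@(crit-I@(_ , ind-I , _) , _)
                                        (crit-A@(_ , ind-A , d≤dA) , max-A) =
    (critical⊆I∪NI max-crit-I crit-A , ind-A , λ Y Y⊆X → begin
      d G X Y  ≤⟨ d[I∪NI]≤d {I} I-critical ind-I Y⊆X ⟩
      d G ⊤ I  ≤⟨ d≤dA I ⊆⊤ ⟩
      d G ⊤ A  ≤⟨ d-antimonoˡ {X} {⊤} {A} ⊆⊤ ⟩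
      d G X A  ∎) ,
    λ B (B⊆X , ind-B , _) →
      ℕ.≤-trans (independent⊆I∪NI⇒∣B∣≤∣I∣ {I} I-critical ind-B B⊆X) (max-A I crit-I)
    where
    open ℤ.≤-Reasoning
    X : Subset n
    X = I ∪ N G ⊤ I
    I-critical : CriticalSet I
    I-critical = critical⇒criticalSet crit-I

lemma2p2 : (n : ℕ) (G : Graph n) (I : Subset n) → MaxCritical G ⊤ I →
    ((v : Fin n) → InDiadem G ⊤ v → InDiadem G (I ∪ N G ⊤ I) v) ×
    ((v : Fin n) → InNucleus G (I ∪ N G ⊤ I) v → InNucleus G ⊤ v)
lemma2p2 n G I max-crit-I =
  (λ v (A , max-crit-A , v∈A) → A , restrict max-crit-A , v∈A) ,
  (λ v v∈nucleus A max-crit-A → v∈nucleus A (restrict max-crit-A))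
  where
  restrict : ∀ {A} → MaxCritical G ⊤ A → MaxCritical G (I ∪ N G ⊤ I) A
  restrict = maxCritical⇒maxCritical[I∪NI] G max-crit-I
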